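{- Let $n$ be a positive integer and let $B=(b_{i,j})$ be the $n\times 2n$ matrix with rows indexed by $1,\dots,n$ and columns indexed by $1,\dots,n,-1,\dots,-n$, where $b_{n,n}=-2n+1$ and all other entries equal $1$. Then $\operatorname{hoperm}_n(B)=0$.
   Context: For an $n\times 2n$ matrix $Y=(y_{i,j})$ with rows indexed by $1,\dots,n$ and columns indexed by $1,\dots,n,-1,\dots,-n$, $\operatorname{hoperm}_n(Y)=\sum_{\sigma\in S_n}\sum_{(\epsilon_1,\dots,\epsilon_n)\in\{\pm1\}^n}\prod_{i=1}^n y_{i,\epsilon_i\sigma(i)}$. -}

module Defs where

open import Data.Nat as ℕ using (ℕ; zero; suc; _∸_)
open import Data.Integer as ℤ using (ℤ; +_; _-_)
open import Data.Fin as Fin using (Fin; zero; suc; toℕ)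
open import Data.Sign using (Sign)
open import Data.Bool using (Bool; true; false; _∧_; _∨_; not; if_then_else_)
open import Data.List using (List; []; _∷_; [_]; map; concatMap; filter; allFin)
open import Data.Bool.ListAction using (and)
import Data.List as L
open import Data.Product using (_×_; _,_)
open import Relation.Nullary.Decidable using (⌊_⌋; does)
open import Relation.Binary.PropositionalEquality using (_≡_)

-- Column  +j  (resp. -j), for j : Fin n standing for j+1, is encoded as
-- (Sign.+ , j)  (resp. (Sign.- , j)).  So  M i s j = y_{i+1, s(j+1)}.
HMatrix : ℕ → Set
HMatrix n = Fin n → Sign → Fin n → ℤ

funs : {A : Set} (k : ℕ) → List A → List (Fin k → A)
funs zero    xs = [ (λ ()) ]
funs (suc k) xs =
  concatMap (λ a → map (λ f → λ { zero → a ; (suc i) → f i }) (funs k xs)) xs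

injectiveᵇ : {n : ℕ} → (Fin n → Fin n) → Bool
injectiveᵇ {n} σ =
  and (concatMap (λ i → map (λ j → ⌊ i Fin.≟ j ⌋ ∨ not ⌊ σ i Fin.≟ σ j ⌋) (allFin n)) (allFin n))

permutations : (n : ℕ) → List (Fin n → Fin n)
permutations n = filter (λ σ → injectiveᵇ σ Data.Bool.≟ true) (funs n (allFin n))
  where import Data.Bool

signVectors : (n : ℕ) → List (Fin n → Sign)
signVectors n = funs n (Sign.+ ∷ Sign.- ∷ [])

sumℤ : List ℤ → ℤ
sumℤ = L.foldr ℤ._+_ (+ 0)

prodFin : (n : ℕ) → (Fin n → ℤ) → ℤ
prodFin n f = L.foldr ℤ._*_ (+ 1) (map f (allFin n))

hoperm : (n : ℕ) → HMatrix n → ℤ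
hoperm n Y =
  sumℤ (map (λ σ → sumℤ (map (λ ε → prodFin n (λ i → Y i (ε i) (σ i))) (signVectors n)))
            (permutations n))

-- The matrix B: b_{n,n} = -2n+1, all other entries equal 1.
-- (Row n / column n correspond to index toℕ i = n ∸ 1, sign +.)
isPlus : Sign → Bool
isPlus Sign.+ = true
isPlus Sign.- = false

B : (n : ℕ) → HMatrix n
B n i s j =
  if ⌊ toℕ i ℕ.≟ (n ∸ 1) ⌋ ∧ isPlus s ∧ ⌊ toℕ j ℕ.≟ (n ∸ 1) ⌋
  then + 1 - + (2 ℕ.* n)
  else + 1

-- Summing over the signs first, hoperm_n Y is the permanent of the n × n matrix
-- y_{i,j} + y_{i,-j}.  For B every row of that matrix is constantly 2 except the last,
-- (2, …, 2, 2 - 2n), whose entries add up to 0.  Expanding a permanent row by row, each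
-- row choosing a column not used by the earlier ones, shows that a (k+1) × (k+1) permanent
-- whose first k rows are constantly α and whose last row is w equals α^k k! · Σ_j w_j.
module Submission where

open import Defs
open import Data.Nat using (ℕ; _≤_)
open import Data.Integer using (+_)
open import Relation.Binary.PropositionalEquality using (_≡_)

open import Data.Nat as ℕ using (zero; suc)
open import Data.Integer as ℤ using (ℤ; _+_; _*_; _-_)
open import Data.Integer.Properties
  using ( +-identityˡ; +-identityʳ; +-assoc; +-inverseʳ; *-zeroʳ; *-identityʳ; *-identityˡ
        ; *-assoc; *-distribˡ-+; *-distribʳ-+; suc-*; pos-*)
open import Data.Integer.Tactic.RingSolver using (solve-∀)
open import Data.Fin as Fin using (Fin; zero; suc; toℕ; fromℕ)
open import Data.Fin.Properties using (_≟_; suc-injective; 0≢1+n; ¬Fin0; toℕ-injective; toℕ-fromℕ)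
open import Data.Bool as Bool using (Bool; true; false; _∧_; _∨_; not; T; if_then_else_)
open import Data.Bool.Properties
  using (T-≡; T-∨; ∨-identityʳ; ∧-conicalˡ; ∧-conicalʳ; ∨-conicalˡ; ∨-conicalʳ; not-injective; ⇔→≡)
import Data.Bool.ListAction as Bools
open import Data.Sign using (Sign)
open import Data.List as List using (List; []; _∷_; _++_; map; concatMap; filter; allFin)
open import Data.List.Properties using (map-cong; map-++; map-∘; map-tabulate; map-id)
open import Data.List.Relation.Unary.All.Properties
  using (all⁺; all⁻; concat⁺; concat⁻; map⁺; map⁻; tabulate⁺; tabulate⁻)
open import Data.Product using (_×_; _,_; proj₁; proj₂)
open import Data.Sum using (inj₁; inj₂)
open import Function using (_∘_; id)
open import Function.Bundles using (_⇔_; mk⇔; Equivalence)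
open import Function.Definitions using (Injective)
open import Function.Properties.Equivalence using () renaming (sym to ⇔-sym)
open import Relation.Nullary using (¬_; contradiction; yes; no)
open import Relation.Nullary.Decidable
  using ( does; ⌊_⌋; T?; isYes≗does; does-⇔; dec-true; dec-false
        ; toWitness; toWitnessFalse; fromWitnessFalse)
open import Relation.Unary using (Pred; Decidable)
open import Relation.Binary.PropositionalEquality
  using (refl; sym; trans; subst; cong; cong₂; _≗_; module ≡-Reasoning)

open ≡-Reasoning

sumℤ-++ : ∀ xs ys → sumℤ (xs ++ ys) ≡ sumℤ xs + sumℤ ys
sumℤ-++ []       ys = sym (+-identityˡ _)
sumℤ-++ (x ∷ xs) ys = trans (cong (_+_ x) (sumℤ-++ xs ys)) (sym (+-assoc x _ _))

module _ {A : Set} where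

  sumℤ-map-cong : ∀ {f g : A → ℤ} → f ≗ g → ∀ xs → sumℤ (map f xs) ≡ sumℤ (map g xs)
  sumℤ-map-cong f≗g xs = cong sumℤ (map-cong f≗g xs)

  sumℤ-map-0 : ∀ (xs : List A) → sumℤ (map (λ _ → + 0) xs) ≡ + 0
  sumℤ-map-0 []       = refl
  sumℤ-map-0 (x ∷ xs) = trans (+-identityˡ _) (sumℤ-map-0 xs)

  sumℤ-map-if : ∀ s (f : A → ℤ) xs →
                sumℤ (map (λ x → if s then + 0 else f x) xs) ≡ (if s then + 0 else sumℤ (map f xs))
  sumℤ-map-if true  f xs = sumℤ-map-0 xs
  sumℤ-map-if false f xs = refl

  sumℤ-map-*ˡ : ∀ c (f : A → ℤ) xs → sumℤ (map (λ x → c * f x) xs) ≡ c * sumℤ (map f xs)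
  sumℤ-map-*ˡ c f []       = sym (*-zeroʳ c)
  sumℤ-map-*ˡ c f (x ∷ xs) =
    trans (cong (_+_ (c * f x)) (sumℤ-map-*ˡ c f xs)) (sym (*-distribˡ-+ c (f x) _))

  sumℤ-map-*ʳ : ∀ (f : A → ℤ) c xs → sumℤ (map (λ x → f x * c) xs) ≡ sumℤ (map f xs) * c
  sumℤ-map-*ʳ f c []       = refl
  sumℤ-map-*ʳ f c (x ∷ xs) =
    trans (cong (_+_ (f x * c)) (sumℤ-map-*ʳ f c xs)) (sym (*-distribʳ-+ c (f x) _))

  sumℤ-map-- : ∀ (f g : A → ℤ) xs →
               sumℤ (map (λ x → f x - g x) xs) ≡ sumℤ (map f xs) - sumℤ (map g xs)
  sumℤ-map-- f g []       = refl
  sumℤ-map-- f g (x ∷ xs) =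
    trans (cong (_+_ (f x - g x)) (sumℤ-map-- f g xs)) (interchange (f x) (g x) _ _)
    where
    interchange : ∀ a b c d → (a - b) + (c - d) ≡ (a + c) - (b + d)
    interchange = solve-∀

  sumℤ-filter : ∀ {ℓ} {P : Pred A ℓ} (P? : Decidable P) (f : A → ℤ) xs →
                sumℤ (map f (filter P? xs)) ≡ sumℤ (map (λ x → if does (P? x) then f x else + 0) xs)
  sumℤ-filter P? f []       = refl
  sumℤ-filter P? f (x ∷ xs) with does (P? x)
  ... | true  = cong (_+_ (f x)) (sumℤ-filter P? f xs)
  ... | false = trans (sumℤ-filter P? f xs) (sym (+-identityˡ _))

sumℤ-concatMap : ∀ {A C : Set} (f : C → ℤ) (g : A → List C) xs →
                 sumℤ (map f (concatMap g xs)) ≡ sumℤ (map (λ a → sumℤ (map f (g a))) xs)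
sumℤ-concatMap f g []       = refl
sumℤ-concatMap f g (x ∷ xs) = begin
  sumℤ (map f (g x ++ concatMap g xs))
    ≡⟨ cong sumℤ (map-++ f (g x) _) ⟩
  sumℤ (map f (g x) ++ map f (concatMap g xs))
    ≡⟨ sumℤ-++ (map f (g x)) _ ⟩
  sumℤ (map f (g x)) + sumℤ (map f (concatMap g xs))
    ≡⟨ cong (_+_ (sumℤ (map f (g x)))) (sumℤ-concatMap f g xs) ⟩
  sumℤ (map f (g x)) + sumℤ (map (λ a → sumℤ (map f (g a))) xs) ∎

sumFin : (n : ℕ) → (Fin n → ℤ) → ℤ
sumFin n f = sumℤ (map f (allFin n))

map-allFin-suc : ∀ {A : Set} {n} (f : Fin (suc n) → A) →
                 map f (allFin (suc n)) ≡ f zero ∷ map (f ∘ suc) (allFin n)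
map-allFin-suc f = cong (f zero ∷_) (trans (map-tabulate suc f) (sym (map-tabulate id (f ∘ suc))))

sumFin-suc : ∀ {n} (f : Fin (suc n) → ℤ) → sumFin (suc n) f ≡ f zero + sumFin n (f ∘ suc)
sumFin-suc f = cong sumℤ (map-allFin-suc f)

prodFin-suc : ∀ {n} (f : Fin (suc n) → ℤ) → prodFin (suc n) f ≡ f zero * prodFin n (f ∘ suc)
prodFin-suc f = cong (List.foldr _*_ (+ 1)) (map-allFin-suc f)

prodFin-cong : ∀ n {f g : Fin n → ℤ} → f ≗ g → prodFin n f ≡ prodFin n g
prodFin-cong n f≗g = cong (List.foldr _*_ (+ 1)) (map-cong f≗g (allFin n))

sumFin-const : ∀ n x → sumFin n (λ _ → x) ≡ + n * x
sumFin-const zero    x = refl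
sumFin-const (suc n) x =
  trans (sumFin-suc {n} (λ _ → x)) (trans (cong (_+_ x) (sumFin-const n x)) (sym (suc-* (+ n) x)))

-- Stated with `does` rather than `⌊_⌋`: `does (suc j ≟ suc a)` computes to `does (j ≟ a)`,
-- whereas `⌊ suc j ≟ suc a ⌋` is stuck.
sumFin-delta : ∀ {n} (a : Fin n) (f : Fin n → ℤ) →
               sumFin n (λ j → if does (j ≟ a) then f j else + 0) ≡ f a
sumFin-delta {suc n} zero    f = begin
  sumFin (suc n) (λ j → if does (j ≟ zero) then f j else + 0)
    ≡⟨ sumFin-suc (λ j → if does (j ≟ zero) then f j else + 0) ⟩
  f zero + sumℤ (map (λ _ → + 0) (allFin n))
    ≡⟨ cong (_+_ (f zero)) (sumℤ-map-0 (allFin n)) ⟩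
  f zero + + 0
    ≡⟨ +-identityʳ (f zero) ⟩
  f zero ∎
sumFin-delta {suc n} (suc a) f = begin
  sumFin (suc n) (λ j → if does (j ≟ suc a) then f j else + 0)
    ≡⟨ sumFin-suc (λ j → if does (j ≟ suc a) then f j else + 0) ⟩
  + 0 + sumFin n (λ j → if does (j ≟ a) then f (suc j) else + 0)
    ≡⟨ +-identityˡ _ ⟩
  sumFin n (λ j → if does (j ≟ a) then f (suc j) else + 0)
    ≡⟨ sumFin-delta a (f ∘ suc) ⟩
  f (suc a) ∎

sumℤ-funs-suc : ∀ {A : Set} k (xs : List A) (G : A → (Fin k → A) → ℤ) →
                sumℤ (map (λ h → G (h zero) (h ∘ suc)) (funs (suc k) xs))
                ≡ sumℤ (map (λ a → sumℤ (map (G a) (funs k xs))) xs)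
sumℤ-funs-suc k xs G =
  trans (sumℤ-concatMap _ _ xs) (sumℤ-map-cong (λ a → cong sumℤ (sym (map-∘ (funs k xs)))) xs)

sumℤ-funs-prodFin : ∀ {A : Set} k (xs : List A) (h : Fin k → A → ℤ) →
                    sumℤ (map (λ ε → prodFin k (λ i → h i (ε i))) (funs k xs))
                    ≡ prodFin k (λ i → sumℤ (map (h i) xs))
sumℤ-funs-prodFin zero    xs h = refl
sumℤ-funs-prodFin (suc k) xs h = begin
  sumℤ (map (λ ε → prodFin (suc k) (λ i → h i (ε i))) (funs (suc k) xs))
    ≡⟨ sumℤ-map-cong (λ ε → prodFin-suc (λ i → h i (ε i))) (funs (suc k) xs) ⟩
  sumℤ (map (λ ε → h zero (ε zero) * prodFin k (λ i → h (suc i) (ε (suc i)))) (funs (suc k) xs))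
    ≡⟨ sumℤ-funs-suc k xs (λ a ε → h zero a * prodFin k (λ i → h (suc i) (ε i))) ⟩
  sumℤ (map (λ a → sumℤ (map (λ ε → h zero a * prodFin k (λ i → h (suc i) (ε i))) (funs k xs))) xs)
    ≡⟨ sumℤ-map-cong (λ a → trans (sumℤ-map-*ˡ (h zero a) _ (funs k xs))
                                   (cong (h zero a *_) (sumℤ-funs-prodFin k xs (h ∘ suc)))) xs ⟩
  sumℤ (map (λ a → h zero a * prodFin k (λ i → sumℤ (map (h (suc i)) xs))) xs)
    ≡⟨ sumℤ-map-*ʳ (h zero) _ xs ⟩
  sumℤ (map (h zero) xs) * prodFin k (λ i → sumℤ (map (h (suc i)) xs))
    ≡⟨ sym (prodFin-suc (λ i → sumℤ (map (h i) xs))) ⟩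
  prodFin (suc k) (λ i → sumℤ (map (h i) xs)) ∎

perm : (n : ℕ) → (Fin n → Fin n → ℤ) → ℤ
perm n M = sumℤ (map (λ σ → prodFin n (λ i → M i (σ i))) (permutations n))

hoperm≡perm : ∀ n (Y : HMatrix n) → hoperm n Y ≡ perm n (λ i j → Y i Sign.+ j + Y i Sign.- j)
hoperm≡perm n Y = sumℤ-map-cong sum-signs (permutations n)
  where
  sum-signs : ∀ σ → sumℤ (map (λ ε → prodFin n (λ i → Y i (ε i) (σ i))) (signVectors n))
                    ≡ prodFin n (λ i → Y i Sign.+ (σ i) + Y i Sign.- (σ i))
  sum-signs σ = trans (sumℤ-funs-prodFin n _ (λ i s → Y i s (σ i)))
                      (prodFin-cong n (λ i → cong (_+_ (Y i Sign.+ (σ i))) (+-identityʳ _)))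

perm-cong : ∀ n {M M′ : Fin n → Fin n → ℤ} → (∀ i j → M i j ≡ M′ i j) → perm n M ≡ perm n M′
perm-cong n M≡M′ = sumℤ-map-cong (λ σ → prodFin-cong n (λ i → M≡M′ i (σ i))) (permutations n)

injectiveᵇ-⇔ : ∀ {n} (σ : Fin n → Fin n) → injectiveᵇ σ ≡ true ⇔ Injective _≡_ _≡_ σ
injectiveᵇ-⇔ {n} σ = mk⇔ sound complete
  where
  pairTest : Fin n → Fin n → Bool
  pairTest i j = ⌊ i ≟ j ⌋ ∨ not ⌊ σ i ≟ σ j ⌋

  row : Fin n → List Bool
  row i = map (pairTest i) (allFin n)

  tests : List Bool
  tests = concatMap row (allFin n)

  and≡all : Bools.and tests ≡ Bools.all id tests
  and≡all = cong Bools.and (sym (map-id tests))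

  pairTest-sound : injectiveᵇ σ ≡ true → ∀ i j → T (pairTest i j)
  pairTest-sound e i j =
    tabulate⁻ {f = id} (map⁻ {f = pairTest i}
      (tabulate⁻ {f = id} (map⁻ {f = row} (concat⁻ (all⁺ id tests
        (subst T and≡all (Equivalence.from T-≡ e))))) i)) j

  sound : injectiveᵇ σ ≡ true → Injective _≡_ _≡_ σ
  sound e {i} {j} σi≡σj with Equivalence.to (T-∨ {⌊ i ≟ j ⌋}) (pairTest-sound e i j)
  ... | inj₁ i≡j   = toWitness i≡j
  ... | inj₂ σi≢σj = contradiction σi≡σj (toWitnessFalse σi≢σj)

  pairTest-complete : Injective _≡_ _≡_ σ → ∀ i j → T (pairTest i j)
  pairTest-complete inj i j with i ≟ j
  ... | yes _   = _
  ... | no  i≢j = fromWitnessFalse (λ σi≡σj → i≢j (inj σi≡σj))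

  complete : Injective _≡_ _≡_ σ → injectiveᵇ σ ≡ true
  complete inj = Equivalence.to T-≡ (subst T (sym and≡all) (all⁻ id (concat⁺ (map⁺ (tabulate⁺
      (λ i → map⁺ (tabulate⁺ (pairTest-complete inj i))))))))

module _ {n : ℕ} where

  insert : Fin n → (Fin n → Bool) → Fin n → Bool
  insert a S j = S j ∨ does (j ≟ a)

  injectiveAvoidingᵇ : ∀ {k} → (Fin n → Bool) → (Fin k → Fin n) → Bool
  injectiveAvoidingᵇ {zero}  S g = true
  injectiveAvoidingᵇ {suc k} S g = not (S (g zero)) ∧ injectiveAvoidingᵇ (insert (g zero) S) (g ∘ suc)

  injectiveAvoidingᵇ-sound : ∀ {k} S (g : Fin k → Fin n) → injectiveAvoidingᵇ S g ≡ true →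
                             Injective _≡_ _≡_ g × (∀ i → S (g i) ≡ false)
  injectiveAvoidingᵇ-sound {zero}  S g _ = (λ {i} → contradiction i ¬Fin0) , (λ i → contradiction i ¬Fin0)
  injectiveAvoidingᵇ-sound {suc k} S g e = injective , avoids
    where
    tail : Injective _≡_ _≡_ (g ∘ suc) × (∀ i → insert (g zero) S (g (suc i)) ≡ false)
    tail = injectiveAvoidingᵇ-sound (insert (g zero) S) (g ∘ suc) (∧-conicalʳ _ _ e)

    tail-fresh : ∀ i → ¬ g (suc i) ≡ g zero
    tail-fresh i p =
      contradiction (trans (sym (dec-true (g (suc i) ≟ g zero) p)) (∨-conicalʳ _ _ (proj₂ tail i))) λ ()

    injective : Injective _≡_ _≡_ g
    injective {zero}  {zero}  _ = refl
    injective {zero}  {suc j} p = contradiction (sym p) (tail-fresh j)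
    injective {suc i} {zero}  p = contradiction p (tail-fresh i)
    injective {suc i} {suc j} p = cong suc (proj₁ tail p)

    avoids : ∀ i → S (g i) ≡ false
    avoids zero    = not-injective (∧-conicalˡ _ _ e)
    avoids (suc i) = ∨-conicalˡ _ _ (proj₂ tail i)

  injectiveAvoidingᵇ-complete : ∀ {k} S (g : Fin k → Fin n) →
                                Injective _≡_ _≡_ g → (∀ i → S (g i) ≡ false) →
                                injectiveAvoidingᵇ S g ≡ true
  injectiveAvoidingᵇ-complete {zero}  S g _ _ = refl
  injectiveAvoidingᵇ-complete {suc k} S g inj avoids =
    cong₂ _∧_ (cong not (avoids zero))
              (injectiveAvoidingᵇ-complete (insert (g zero) S) (g ∘ suc) (suc-injective ∘ inj) tail-avoids)
    where
    tail-avoids : ∀ i → insert (g zero) S (g (suc i)) ≡ false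
    tail-avoids i = cong₂ _∨_ (avoids (suc i)) (dec-false (g (suc i) ≟ g zero) (0≢1+n ∘ sym ∘ inj))

  injectiveAvoidingᵇ-∅≡injectiveᵇ : (σ : Fin n → Fin n) →
                                    injectiveAvoidingᵇ (λ _ → false) σ ≡ injectiveᵇ σ
  injectiveAvoidingᵇ-∅≡injectiveᵇ σ = ⇔→≡ (mk⇔
    (Equivalence.from (injectiveᵇ-⇔ σ) ∘ proj₁ ∘ injectiveAvoidingᵇ-sound _ σ)
    (λ e → injectiveAvoidingᵇ-complete _ σ (Equivalence.to (injectiveᵇ-⇔ σ) e) (λ _ → refl)))

  partialPerm : ∀ k → (Fin n → Bool) → (Fin k → Fin n → ℤ) → ℤ
  partialPerm k S c =
    sumℤ (map (λ g → if injectiveAvoidingᵇ S g then prodFin k (λ i → c i (g i)) else + 0) (funs k (allFin n)))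

  perm≡partialPerm : ∀ (M : Fin n → Fin n → ℤ) → perm n M ≡ partialPerm n (λ _ → false) M
  perm≡partialPerm M =
    trans (sumℤ-filter (λ σ → injectiveᵇ σ Bool.≟ true) _ (funs n (allFin n)))
          (sumℤ-map-cong (λ σ → cong (λ b → if b then prodFin n (λ i → M i (σ i)) else + 0) (same-test σ))
                         (funs n (allFin n)))
    where
    same-test : ∀ σ → does (injectiveᵇ σ Bool.≟ true) ≡ injectiveAvoidingᵇ (λ _ → false) σ
    same-test σ = trans (does-⇔ (⇔-sym T-≡) (injectiveᵇ σ Bool.≟ true) (T? (injectiveᵇ σ)))
                        (sym (injectiveAvoidingᵇ-∅≡injectiveᵇ σ))

  partialPerm-suc : ∀ k S (c : Fin (suc k) → Fin n → ℤ) →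
                    partialPerm (suc k) S c
                    ≡ sumFin n (λ a → if S a then + 0 else c zero a * partialPerm k (insert a S) (c ∘ suc))
  partialPerm-suc k S c = begin
    partialPerm (suc k) S c
      ≡⟨ sumℤ-map-cong (λ g → cong (λ x → if injectiveAvoidingᵇ S g then x else + 0)
                                   (prodFin-suc (λ i → c i (g i)))) (funs (suc k) (allFin n)) ⟩
    sumℤ (map (λ g → term (g zero) (g ∘ suc)) (funs (suc k) (allFin n)))
      ≡⟨ sumℤ-funs-suc k (allFin n) term ⟩
    sumFin n (λ a → sumℤ (map (term a) (funs k (allFin n))))
      ≡⟨ sumℤ-map-cong sum-term (allFin n) ⟩
    sumFin n (λ a → if S a then + 0 else c zero a * partialPerm k (insert a S) (c ∘ suc)) ∎
    where
    if-not-∧-* : ∀ s b x y → (if not s ∧ b then x * y else + 0)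
                             ≡ (if s then + 0 else x * (if b then y else + 0))
    if-not-∧-* true  b     x y = refl
    if-not-∧-* false true  x y = refl
    if-not-∧-* false false x y = sym (*-zeroʳ x)

    term : Fin n → (Fin k → Fin n) → ℤ
    term a g = if not (S a) ∧ injectiveAvoidingᵇ (insert a S) g
               then c zero a * prodFin k (λ i → c (suc i) (g i)) else + 0

    rest : Fin n → (Fin k → Fin n) → ℤ
    rest a g = if injectiveAvoidingᵇ (insert a S) g then prodFin k (λ i → c (suc i) (g i)) else + 0

    sum-term : ∀ a → sumℤ (map (term a) (funs k (allFin n)))
                     ≡ (if S a then + 0 else c zero a * partialPerm k (insert a S) (c ∘ suc))
    sum-term a = begin
      sumℤ (map (term a) (funs k (allFin n)))
        ≡⟨ sumℤ-map-cong (λ g → if-not-∧-* (S a) _ (c zero a) _) (funs k (allFin n)) ⟩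
      sumℤ (map (λ g → if S a then + 0 else c zero a * rest a g) (funs k (allFin n)))
        ≡⟨ sumℤ-map-if (S a) _ (funs k (allFin n)) ⟩
      (if S a then + 0 else sumℤ (map (λ g → c zero a * rest a g) (funs k (allFin n))))
        ≡⟨ cong (λ x → if S a then + 0 else x) (sumℤ-map-*ˡ (c zero a) (rest a) (funs k (allFin n))) ⟩
      (if S a then + 0 else c zero a * partialPerm k (insert a S) (c ∘ suc)) ∎

  sumOutside : (Fin n → Bool) → (Fin n → ℤ) → ℤ
  sumOutside S f = sumFin n (λ j → if S j then + 0 else f j)

  sumOutside-insert : ∀ S a (f : Fin n → ℤ) → S a ≡ false →
                      sumOutside (insert a S) f ≡ sumOutside S f - f a
  sumOutside-insert S a f Sa = begin
    sumOutside (insert a S) f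
      ≡⟨ sumℤ-map-cong split (allFin n) ⟩
    sumFin n (λ j → (if S j then + 0 else f j) - (if does (j ≟ a) then f j else + 0))
      ≡⟨ sumℤ-map-- (λ j → if S j then + 0 else f j) _ (allFin n) ⟩
    sumOutside S f - sumFin n (λ j → if does (j ≟ a) then f j else + 0)
      ≡⟨ cong (sumOutside S f -_) (sumFin-delta a f) ⟩
    sumOutside S f - f a ∎
    where
    split : ∀ j → (if S j ∨ does (j ≟ a) then + 0 else f j)
                  ≡ (if S j then + 0 else f j) - (if does (j ≟ a) then f j else + 0)
    split j with j ≟ a
    ... | yes refl rewrite Sa = sym (+-inverseʳ (f j))
    ... | no  _    rewrite ∨-identityʳ (S j) = sym (+-identityʳ _)

  sumOutside-const-- : ∀ S x (f : Fin n → ℤ) →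
                       sumOutside S (λ j → x - f j) ≡ x * sumOutside S (λ _ → + 1) - sumOutside S f
  sumOutside-const-- S x f = begin
    sumOutside S (λ j → x - f j)
      ≡⟨ sumℤ-map-cong split (allFin n) ⟩
    sumFin n (λ j → x * (if S j then + 0 else + 1) - (if S j then + 0 else f j))
      ≡⟨ sumℤ-map-- _ (λ j → if S j then + 0 else f j) (allFin n) ⟩
    sumFin n (λ j → x * (if S j then + 0 else + 1)) - sumOutside S f
      ≡⟨ cong (_- sumOutside S f) (sumℤ-map-*ˡ x _ (allFin n)) ⟩
    x * sumOutside S (λ _ → + 1) - sumOutside S f ∎
    where
    split : ∀ j → (if S j then + 0 else x - f j) ≡ x * (if S j then + 0 else + 1) - (if S j then + 0 else f j)
    split j with S j
    ... | true  = sym (trans (+-identityʳ (x * + 0)) (*-zeroʳ x))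
    ... | false = cong (_- f j) (sym (*-identityʳ x))

scaledFalling : ℤ → ℕ → ℤ → ℤ
scaledFalling α zero    m = + 1
scaledFalling α (suc k) m = α * (m - + 1) * scaledFalling α k (m - + 1)

module _ {n : ℕ} where

  lastRow : ∀ k → ℤ → (Fin n → ℤ) → Fin (suc k) → Fin n → ℤ
  lastRow k α w i j = if toℕ i ℕ.≡ᵇ k then w j else α

  partialPerm-lastRow : ∀ α w k S → partialPerm (suc k) S (lastRow k α w)
                                    ≡ scaledFalling α k (sumOutside S (λ _ → + 1)) * sumOutside S w
  partialPerm-lastRow α w zero S = begin
    partialPerm 1 S (lastRow zero α w)
      ≡⟨ partialPerm-suc zero S (lastRow zero α w) ⟩
    sumFin n (λ a → if S a then + 0 else w a * + 1)
      ≡⟨ sumℤ-map-cong (λ a → cong (λ x → if S a then + 0 else x) (*-identityʳ (w a))) (allFin n) ⟩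
    sumOutside S w
      ≡⟨ sym (*-identityˡ (sumOutside S w)) ⟩
    + 1 * sumOutside S w ∎
  partialPerm-lastRow α w (suc k) S = begin
    partialPerm (suc (suc k)) S (lastRow (suc k) α w)
      ≡⟨ partialPerm-suc (suc k) S (lastRow (suc k) α w) ⟩
    sumFin n (λ a → if S a then + 0 else α * partialPerm (suc k) (insert a S) (lastRow k α w))
      ≡⟨ sumℤ-map-cong step (allFin n) ⟩
    sumFin n (λ a → α * F * (if S a then + 0 else W - w a))
      ≡⟨ sumℤ-map-*ˡ (α * F) _ (allFin n) ⟩
    α * F * sumOutside S (λ a → W - w a)
      ≡⟨ cong (α * F *_) (sumOutside-const-- S W w) ⟩
    α * F * (W * free - W)
      ≡⟨ rearrange α F W free ⟩
    α * (free - + 1) * F * W ∎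
    where
    free W F : ℤ
    free = sumOutside S (λ _ → + 1)
    W    = sumOutside S w
    F    = scaledFalling α k (free - + 1)

    step : ∀ a → (if S a then + 0 else α * partialPerm (suc k) (insert a S) (lastRow k α w))
                 ≡ α * F * (if S a then + 0 else W - w a)
    step a with S a in Sa
    ... | true  = sym (*-zeroʳ (α * F))
    ... | false = trans (cong (α *_) (trans (partialPerm-lastRow α w k (insert a S))
                          (cong₂ (λ m x → scaledFalling α k m * x)
                                 (sumOutside-insert S a (λ _ → + 1) Sa) (sumOutside-insert S a w Sa))))
                        (sym (*-assoc α F (W - w a)))

    rearrange : ∀ α F W f → α * F * (W * f - W) ≡ α * (f - + 1) * F * W
    rearrange = solve-∀

-- b_{n,j} + b_{n,-j} for n = suc m
bLastRow : (m : ℕ) → Fin (suc m) → ℤ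
bLastRow m j = (if ⌊ toℕ j ℕ.≟ m ⌋ then + 1 - + (2 ℕ.* suc m) else + 1) + + 1

B-folded≡lastRow : ∀ m i j → B (suc m) i Sign.+ j + B (suc m) i Sign.- j ≡ lastRow m (+ 2) (bLastRow m) i j
B-folded≡lastRow m i j =
  trans (byCases ⌊ toℕ i ℕ.≟ m ⌋ ⌊ toℕ j ℕ.≟ m ⌋)
        (cong (λ b → if b then bLastRow m j else + 2) (isYes≗does (toℕ i ℕ.≟ m)))
  where
  X : ℤ
  X = + 1 - + (2 ℕ.* suc m)

  byCases : ∀ b c → (if b ∧ c then X else + 1) + (if b ∧ false then X else + 1)
                    ≡ (if b then (if c then X else + 1) + + 1 else + 2)
  byCases true  c = refl
  byCases false c = refl

sumFin-bLastRow : ∀ m → sumFin (suc m) (bLastRow m) ≡ + 0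
sumFin-bLastRow m = begin
  sumFin (suc m) (bLastRow m)
    ≡⟨ sumℤ-map-cong pointwise (allFin (suc m)) ⟩
  sumFin (suc m) (λ j → + 2 - (if does (j ≟ fromℕ m) then M else + 0))
    ≡⟨ sumℤ-map-- (λ _ → + 2) (λ j → if does (j ≟ fromℕ m) then M else + 0) (allFin (suc m)) ⟩
  sumFin (suc m) (λ _ → + 2) - sumFin (suc m) (λ j → if does (j ≟ fromℕ m) then M else + 0)
    ≡⟨ cong₂ _-_ (sumFin-const (suc m) (+ 2)) (sumFin-delta (fromℕ m) (λ _ → M)) ⟩
  + suc m * + 2 - M
    ≡⟨ cong (+ suc m * + 2 -_) (pos-* 2 (suc m)) ⟩
  + suc m * + 2 - + 2 * + suc m
    ≡⟨ cancel (+ suc m) ⟩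
  + 0 ∎
  where
  M : ℤ
  M = + (2 ℕ.* suc m)

  toℕ≡m⇔≡fromℕ : ∀ (j : Fin (suc m)) → toℕ j ≡ m ⇔ j ≡ fromℕ m
  toℕ≡m⇔≡fromℕ j = mk⇔ (λ p → toℕ-injective (trans p (sym (toℕ-fromℕ m))))
                         (λ p → trans (cong toℕ p) (toℕ-fromℕ m))

  byCases : ∀ b → (if b then + 1 - M else + 1) + + 1 ≡ + 2 - (if b then M else + 0)
  byCases true  = shift M
    where
    shift : ∀ x → (+ 1 - x) + + 1 ≡ + 2 - x
    shift = solve-∀
  byCases false = refl

  pointwise : ∀ j → bLastRow m j ≡ + 2 - (if does (j ≟ fromℕ m) then M else + 0)
  pointwise j =
    trans (cong (λ b → (if b then + 1 - M else + 1) + + 1)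
                (trans (isYes≗does (toℕ j ℕ.≟ m))
                       (does-⇔ (toℕ≡m⇔≡fromℕ j) (toℕ j ℕ.≟ m) (j ≟ fromℕ m))))
          (byCases (does (j ≟ fromℕ m)))

  cancel : ∀ x → x * + 2 - + 2 * x ≡ + 0
  cancel = solve-∀

proposition3p7 : (n : ℕ) → 1 ≤ n → hoperm n (B n) ≡ + 0
proposition3p7 (suc m) _ = begin
  hoperm (suc m) (B (suc m))
    ≡⟨ hoperm≡perm (suc m) (B (suc m)) ⟩
  perm (suc m) (λ i j → B (suc m) i Sign.+ j + B (suc m) i Sign.- j)
    ≡⟨ perm-cong (suc m) (B-folded≡lastRow m) ⟩
  perm (suc m) (lastRow m (+ 2) (bLastRow m))
    ≡⟨ perm≡partialPerm (lastRow m (+ 2) (bLastRow m)) ⟩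
  partialPerm (suc m) (λ _ → false) (lastRow m (+ 2) (bLastRow m))
    ≡⟨ partialPerm-lastRow (+ 2) (bLastRow m) m (λ _ → false) ⟩
  coefficient * sumFin (suc m) (bLastRow m)
    ≡⟨ cong (coefficient *_) (sumFin-bLastRow m) ⟩
  coefficient * + 0
    ≡⟨ *-zeroʳ coefficient ⟩
  + 0 ∎
  where
  coefficient : ℤ
  coefficient = scaledFalling (+ 2) m (sumFin (suc m) (λ _ → + 1))
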